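{- Let $\mathcal D$ be a complete $3$-uniform hypergraph whose edges are colored with three colors, and suppose $\mathcal D$ is a disk. Then there is a $5$-element set of vertices of $\mathcal D$ such that all three colors occur among the colors of its $3$-subsets (a $K_5^3$ using all three colors).
   Context: An edge-colored $3$-uniform hypergraph is a disk if it contains three $6$-vertex sets $X_1,X_2,X_3$, each spanning a complete $3$-uniform subhypergraph all of whose edges have one color, with the three colors of $X_1,X_2,X_3$ pairwise different, such that $|X_i\cap X_j|=2$ for all $i\ne j$ and $X_1\cap X_2\cap X_3=\emptyset$. -}

module Defs where

open import Data.Nat using (ℕ)
open import Data.Fin using (Fin)
open import Data.Fin.Subset using (Subset; _∈_; _∩_; ∣_∣; ⊥)
open import Data.Product using (Σ; _×_; ∃-syntax)
open import Relation.Binary.PropositionalEquality using (_≡_; _≢_)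

-- The color of the edge {x,y,z}
-- (x,y,z pairwise distinct) is col x y z; it is required to be invariant
-- under permuting the arguments.  Values on non-distinct triples are
-- irrelevant (never used).
record Coloring (n : ℕ) : Set where
  field
    col   : Fin n → Fin n → Fin n → Fin 3
    sym₁₂ : ∀ x y z → col x y z ≡ col y x z
    sym₂₃ : ∀ x y z → col x y z ≡ col x z y
open Coloring public

Distinct3 : {n : ℕ} → Fin n → Fin n → Fin n → Set
Distinct3 x y z = x ≢ y × y ≢ z × x ≢ z

Monochromatic : {n : ℕ} → Coloring n → Subset n → Fin 3 → Set
Monochromatic C X a =
  ∀ x y z → x ∈ X → y ∈ X → z ∈ X → Distinct3 x y z → col C x y z ≡ a

HasColor : {n : ℕ} → Coloring n → Subset n → Fin 3 → Set
HasColor C X a =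
  ∃[ x ] ∃[ y ] ∃[ z ] (x ∈ X × y ∈ X × z ∈ X × Distinct3 x y z × col C x y z ≡ a)

IsDisk : {n : ℕ} → Coloring n → Set
IsDisk {n} C =
  ∃[ X₁ ] ∃[ X₂ ] ∃[ X₃ ] ∃[ a₁ ] ∃[ a₂ ] ∃[ a₃ ]
    ( ∣ X₁ ∣ ≡ 6 × ∣ X₂ ∣ ≡ 6 × ∣ X₃ ∣ ≡ 6
    × Monochromatic C X₁ a₁ × Monochromatic C X₂ a₂ × Monochromatic C X₃ a₃
    × a₁ ≢ a₂ × a₂ ≢ a₃ × a₁ ≢ a₃
    × ∣ X₁ ∩ X₂ ∣ ≡ 2 × ∣ X₂ ∩ X₃ ∣ ≡ 2 × ∣ X₁ ∩ X₃ ∣ ≡ 2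
    × X₁ ∩ X₂ ∩ X₃ ≡ ⊥ )

module Submission where

-- Let X₁, X₂, X₃ be the monochromatic 6-sets of the disk, of pairwise
-- different colours a₁, a₂, a₃.  Since no vertex lies in all three sets,
-- the "corners" X₁ ∩ X₂, X₂ ∩ X₃ and X₁ ∩ X₃ are pairwise disjoint.  Pick
-- the two vertices p, q of X₁ ∩ X₂, the two vertices r, s of X₂ ∩ X₃ and
-- one vertex t of X₁ ∩ X₃, and let S = {p, q, r, s, t}.  Then S has five
-- elements, and the triples pqt ⊆ X₁, pqr ⊆ X₂, rst ⊆ X₃ have the colours
-- a₁, a₂, a₃; these are all three colours because three pairwise distinct
-- elements of Fin 3 exhaust Fin 3.

open import Defs
open import Data.Nat using (ℕ; suc; _+_; _≤_; s≤s; z≤n)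
open import Data.Nat.Properties using (+-suc; n<1+n; ≤-reflexive)
open import Data.Fin using (Fin; zero; suc; _≟_)
open import Data.Fin.Properties using (<⇒notInjective; suc-injective)
open import Data.Fin.Subset using (Subset; ∣_∣; _∈_; _∩_; _∪_; ⁅_⁆; ⊥; inside; outside)
open import Data.Fin.Subset.Properties
  using (x∈p∩q⁺; x∈p∩q⁻; x∈p∪q⁺; x∈p∪q⁻; ∉⊥; ∣⁅x⁆∣≡1; x∈⁅x⁆; x∈⁅y⁆⇒x≡y)
open import Data.Vec using (Vec; []; _∷_; here; there)
open import Data.Vec.Membership.Propositional using () renaming (_∈_ to _∈ᵥ_)
open import Data.Vec.Relation.Unary.Any using (here; there; any?)
open import Data.Vec.Relation.Unary.AllPairs using ([]; _∷_)
open import Data.Vec.Relation.Unary.All using (All; []; _∷_)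
open import Data.Vec.Relation.Unary.Unique.Propositional using (Unique)
open import Data.Vec.Relation.Unary.Unique.Propositional.Properties using (lookup-injective)
open import Data.Product using (_×_; ∃-syntax; _,_; proj₁; proj₂)
open import Data.Sum using (inj₁; inj₂)
open import Data.Empty renaming (⊥ to Empty) using (⊥-elim)
open import Relation.Nullary using (¬_; yes; no; contradiction)
open import Relation.Binary.PropositionalEquality
  using (_≡_; _≢_; refl; sym; trans; cong; cong₂; subst)

∉⇒all-different : ∀ {n} {x : Fin n} {k} (xs : Vec (Fin n) k) →
  ¬ x ∈ᵥ xs → All (x ≢_) xs
∉⇒all-different []       _   = []
∉⇒all-different (y ∷ ys) x∉ =
  (λ x≡y → x∉ (here x≡y)) ∷ ∉⇒all-different ys (λ x∈ys → x∉ (there x∈ys))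

-- Otherwise x ∷ xs would be a
-- duplicate-free vector of n + 1 elements, i.e. an injection Fin (n+1) → Fin n.
unique-exhausts : ∀ {n} (xs : Vec (Fin n) n) → Unique xs → ∀ x → x ∈ᵥ xs
unique-exhausts {n} xs unique x with any? (x ≟_) xs
... | yes x∈xs = x∈xs
... | no  x∉xs = contradiction
  (λ {i} {j} → lookup-injective (∉⇒all-different xs x∉xs ∷ unique) i j)
  (<⇒notInjective (n<1+n n))

all-colours : ∀ {a₁ a₂ a₃ : Fin 3} → a₁ ≢ a₂ → a₂ ≢ a₃ → a₁ ≢ a₃ →
  ∀ a → a ∈ᵥ (a₁ ∷ a₂ ∷ a₃ ∷ [])
all-colours a₁≢a₂ a₂≢a₃ a₁≢a₃ = unique-exhausts _
  ((a₁≢a₂ ∷ a₁≢a₃ ∷ []) ∷ (a₂≢a₃ ∷ []) ∷ [] ∷ [])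

element-of : ∀ {n} (A : Subset n) → 1 ≤ ∣ A ∣ → ∃[ x ] (x ∈ A)
element-of (inside  ∷ A) _    = zero , here
element-of (outside ∷ A) 1≤∣A∣ with element-of A 1≤∣A∣
... | x , x∈A = suc x , there x∈A

two-elements-of : ∀ {n} (A : Subset n) → 2 ≤ ∣ A ∣ →
  ∃[ x ] ∃[ y ] (x ∈ A × y ∈ A × x ≢ y)
two-elements-of (inside ∷ A) (s≤s 1≤∣A∣) with element-of A 1≤∣A∣
... | y , y∈A = zero , suc y , here , there y∈A , λ ()
two-elements-of (outside ∷ A) 2≤∣A∣ with two-elements-of A 2≤∣A∣
... | x , y , x∈A , y∈A , x≢y =
  suc x , suc y , there x∈A , there y∈A , λ sx≡sy → x≢y (suc-injective sx≡sy)

∣∪∣-disjoint : ∀ {n} (A B : Subset n) → (∀ x → x ∈ A → x ∈ B → Empty) →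
  ∣ A ∪ B ∣ ≡ ∣ A ∣ + ∣ B ∣
∣∪∣-disjoint []            []            _        = refl
∣∪∣-disjoint (inside  ∷ A) (inside  ∷ B) disjoint = ⊥-elim (disjoint zero here here)
∣∪∣-disjoint (inside  ∷ A) (outside ∷ B) disjoint =
  cong suc (∣∪∣-disjoint A B (λ x a b → disjoint (suc x) (there a) (there b)))
∣∪∣-disjoint (outside ∷ A) (inside  ∷ B) disjoint =
  trans (cong suc (∣∪∣-disjoint A B (λ x a b → disjoint (suc x) (there a) (there b))))
        (sym (+-suc ∣ A ∣ ∣ B ∣))
∣∪∣-disjoint (outside ∷ A) (outside ∷ B) disjoint =
  ∣∪∣-disjoint A B (λ x a b → disjoint (suc x) (there a) (there b))

left : ∀ {n} {x : Fin n} {A B : Subset n} → x ∈ A ∩ B → x ∈ A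
left {A = A} {B} x∈A∩B = proj₁ (x∈p∩q⁻ A B x∈A∩B)

right : ∀ {n} {x : Fin n} {A B : Subset n} → x ∈ A ∩ B → x ∈ B
right {A = A} {B} x∈A∩B = proj₂ (x∈p∩q⁻ A B x∈A∩B)

colour-witness : ∀ {n} (C : Coloring n) {X S : Subset n} {a : Fin 3} →
  Monochromatic C X a → ∀ {x y z} →
  x ∈ X → y ∈ X → z ∈ X → x ∈ S → y ∈ S → z ∈ S → Distinct3 x y z →
  HasColor C S a
colour-witness C mono x∈X y∈X z∈X x∈S y∈S z∈S distinct =
  _ , _ , _ , x∈S , y∈S , z∈S , distinct , mono _ _ _ x∈X y∈X z∈X distinct

module Corners {n} {X₁ X₂ X₃ : Subset n} (no-common : X₁ ∩ X₂ ∩ X₃ ≡ ⊥)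
  {p q r s t : Fin n}
  (p∈X₁₂ : p ∈ X₁ ∩ X₂) (q∈X₁₂ : q ∈ X₁ ∩ X₂) (p≢q : p ≢ q)
  (r∈X₂₃ : r ∈ X₂ ∩ X₃) (s∈X₂₃ : s ∈ X₂ ∩ X₃) (r≢s : r ≢ s)
  (t∈X₁₃ : t ∈ X₁ ∩ X₃) where

  not-in-all : ∀ {x} → x ∈ X₁ → x ∈ X₂ → x ∈ X₃ → Empty
  not-in-all {x} x∈X₁ x∈X₂ x∈X₃ =
    ∉⊥ (subst (x ∈_) no-common (x∈p∩q⁺ (x∈X₁ , x∈p∩q⁺ (x∈X₂ , x∈X₃))))

  X₁₂≠X₂₃ : ∀ {x y} → x ∈ X₁ ∩ X₂ → y ∈ X₂ ∩ X₃ → x ≢ y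
  X₁₂≠X₂₃ x∈ y∈ refl = not-in-all (left x∈) (right x∈) (right y∈)

  X₁₂≠X₁₃ : ∀ {x y} → x ∈ X₁ ∩ X₂ → y ∈ X₁ ∩ X₃ → x ≢ y
  X₁₂≠X₁₃ x∈ y∈ refl = not-in-all (left x∈) (right x∈) (right y∈)

  X₂₃≠X₁₃ : ∀ {x y} → x ∈ X₂ ∩ X₃ → y ∈ X₁ ∩ X₃ → x ≢ y
  X₂₃≠X₁₃ x∈ y∈ refl = not-in-all (left y∈) (left x∈) (right x∈)

  S : Subset n
  S = X₁ ∩ X₂ ∪ X₂ ∩ X₃ ∪ ⁅ t ⁆

  ∣S∣ : ∣ X₁ ∩ X₂ ∣ ≡ 2 → ∣ X₂ ∩ X₃ ∣ ≡ 2 → ∣ S ∣ ≡ 5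
  ∣S∣ ∣X₁₂∣≡2 ∣X₂₃∣≡2 =
    trans (∣∪∣-disjoint (X₁ ∩ X₂) (X₂ ∩ X₃ ∪ ⁅ t ⁆) X₁₂-apart)
          (cong₂ _+_ ∣X₁₂∣≡2 (trans (∣∪∣-disjoint (X₂ ∩ X₃) ⁅ t ⁆ X₂₃-apart)
                                     (cong₂ _+_ ∣X₂₃∣≡2 (∣⁅x⁆∣≡1 t))))
    where
    X₂₃-apart : ∀ x → x ∈ X₂ ∩ X₃ → x ∈ ⁅ t ⁆ → Empty
    X₂₃-apart x x∈ x∈⁅t⁆ = X₂₃≠X₁₃ x∈ t∈X₁₃ (x∈⁅y⁆⇒x≡y t x∈⁅t⁆)

    X₁₂-apart : ∀ x → x ∈ X₁ ∩ X₂ → x ∈ X₂ ∩ X₃ ∪ ⁅ t ⁆ → Empty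
    X₁₂-apart x x∈ x∈rest with x∈p∪q⁻ (X₂ ∩ X₃) ⁅ t ⁆ x∈rest
    ... | inj₁ x∈X₂₃  = X₁₂≠X₂₃ x∈ x∈X₂₃ refl
    ... | inj₂ x∈⁅t⁆ = X₁₂≠X₁₃ x∈ t∈X₁₃ (x∈⁅y⁆⇒x≡y t x∈⁅t⁆)

  X₁₂⊆S : ∀ {x} → x ∈ X₁ ∩ X₂ → x ∈ S
  X₁₂⊆S x∈ = x∈p∪q⁺ (inj₁ x∈)

  X₂₃⊆S : ∀ {x} → x ∈ X₂ ∩ X₃ → x ∈ S
  X₂₃⊆S x∈ = x∈p∪q⁺ (inj₂ (x∈p∪q⁺ (inj₁ x∈)))

  t∈S : t ∈ S
  t∈S = x∈p∪q⁺ (inj₂ (x∈p∪q⁺ (inj₂ (x∈⁅x⁆ t))))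

  colour₁ : ∀ (C : Coloring n) {a} → Monochromatic C X₁ a → HasColor C S a
  colour₁ C mono = colour-witness C mono
    (left p∈X₁₂) (left q∈X₁₂) (left t∈X₁₃) (X₁₂⊆S p∈X₁₂) (X₁₂⊆S q∈X₁₂) t∈S
    (p≢q , X₁₂≠X₁₃ q∈X₁₂ t∈X₁₃ , X₁₂≠X₁₃ p∈X₁₂ t∈X₁₃)

  colour₂ : ∀ (C : Coloring n) {a} → Monochromatic C X₂ a → HasColor C S a
  colour₂ C mono = colour-witness C mono
    (right p∈X₁₂) (right q∈X₁₂) (left r∈X₂₃) (X₁₂⊆S p∈X₁₂) (X₁₂⊆S q∈X₁₂) (X₂₃⊆S r∈X₂₃)
    (p≢q , X₁₂≠X₂₃ q∈X₁₂ r∈X₂₃ , X₁₂≠X₂₃ p∈X₁₂ r∈X₂₃)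

  colour₃ : ∀ (C : Coloring n) {a} → Monochromatic C X₃ a → HasColor C S a
  colour₃ C mono = colour-witness C mono
    (right r∈X₂₃) (right s∈X₂₃) (right t∈X₁₃) (X₂₃⊆S r∈X₂₃) (X₂₃⊆S s∈X₂₃) t∈S
    (r≢s , X₂₃≠X₁₃ s∈X₂₃ t∈X₁₃ , X₂₃≠X₁₃ r∈X₂₃ t∈X₁₃)

mainTheorem12 : (n : ℕ) (C : Coloring n) → IsDisk C →
    ∃[ S ] (∣ S ∣ ≡ 5 × ((a : Fin 3) → HasColor C S a))
mainTheorem12 n C (X₁ , X₂ , X₃ , a₁ , a₂ , a₃ , _ , _ , _ , mono₁ , mono₂ , mono₃
                  , a₁≢a₂ , a₂≢a₃ , a₁≢a₃ , ∣X₁₂∣≡2 , ∣X₂₃∣≡2 , ∣X₁₃∣≡2 , no-common)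
  with two-elements-of (X₁ ∩ X₂) (≤-reflexive (sym ∣X₁₂∣≡2))
     | two-elements-of (X₂ ∩ X₃) (≤-reflexive (sym ∣X₂₃∣≡2))
     | element-of (X₁ ∩ X₃) (subst (1 ≤_) (sym ∣X₁₃∣≡2) (s≤s z≤n))
... | p , q , p∈ , q∈ , p≢q | r , s , r∈ , s∈ , r≢s | t , t∈ =
  S , ∣S∣ ∣X₁₂∣≡2 ∣X₂₃∣≡2 , every-colour
  where
  open Corners no-common p∈ q∈ p≢q r∈ s∈ r≢s t∈

  every-colour : (a : Fin 3) → HasColor C S a
  every-colour a with all-colours a₁≢a₂ a₂≢a₃ a₁≢a₃ a
  ... | here refl                 = colour₁ C mono₁
  ... | there (here refl)         = colour₂ C mono₂
  ... | there (there (here refl)) = colour₃ C mono₃
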